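{- Let $\alpha$ be an infinite word over the alphabet $\{0,1\}$ indexed by $\mathbb{N}$. Then $\alpha$ is uniformly recurrent if and only if the age of the structure $C_\alpha$ is ind-minimal.
   Context: For $\alpha=\alpha_0\alpha_1\cdots$, $C_\alpha:=(\mathbb{N},c,u_\alpha)$ where $c=\{(i,i+1):i\in\mathbb{N}\}$ is the consecutivity relation and $u_\alpha=\{i:\alpha_i=1\}$ is a unary relation, viewed as the binary relation $\{(i,i):\alpha_i=1\}$; thus $C_\alpha$ is a binary structure of type 2. A word $\alpha$ is uniformly recurrent if for every finite factor (contiguous finite subword) $u$ of $\alpha$ there is $r$ such that every factor of $\alpha$ of length $r$ contains $u$ as a factor. For binary structures $(E,\rho_1,\dots,\rho_k)$: $A\subseteq E$ is an interval if for all $i$, $a,a'\in A$, $x\notin A$: $x\rho_i a\Leftrightarrow x\rho_i a'$ and $a\rho_i x\Leftrightarrow a'\rho_i x$; indecomposable means only trivial intervals ($\emptyset$, singletons, $E$). $\Omega_k$ is the class of finite binary structures of type $k$ up to isomorphism, $\mathrm{Ind}(\Omega_k)$ its indecomposable members. The age of a structure is the class of its finite restrictions up to isomorphism. A class $\mathcal{C}\subseteq\Omega_k$ is ind-minimal if $\mathcal{C}\cap\mathrm{Ind}(\Omega_k)$ is infinite and for every proper hereditary (closed under embedding) subclass $\mathcal{C}'$ of $\mathcal{C}$, $\mathcal{C}'\cap\mathrm{Ind}(\Omega_k)$ is finite. -}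

module Defs where

open import Data.Nat using (ℕ; zero; suc; _+_; _≤_)
open import Data.Bool using (Bool; true; false)
open import Data.Fin using (Fin; toℕ)
open import Data.Vec using (Vec; lookup)
open import Data.List using (List)
open import Data.List.Relation.Unary.Any using (Any)
open import Data.Product using (Σ; ∃; _×_; _,_)
open import Data.Sum using (_⊎_)
open import Data.Empty using (⊥)
open import Relation.Nullary using (¬_)
open import Relation.Binary.PropositionalEquality using (_≡_)
open import Function.Definitions using (Injective)

Word : Set
Word = ℕ → Bool

OccursAt : ∀ {n} → Word → ℕ → Vec Bool n → Set
OccursAt α i u = ∀ j → lookup u j ≡ α (i + toℕ j)

IsFactor : ∀ {n} → Word → Vec Bool n → Set
IsFactor α u = Σ ℕ λ i → OccursAt α i u

UniformlyRecurrent : Word → Set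
UniformlyRecurrent α =
  ∀ n (u : Vec Bool n) → IsFactor α u →
  Σ ℕ λ r → ∀ p → Σ ℕ λ q → (q + n ≤ r) × OccursAt α (p + q) u

record FinStr (k : ℕ) : Set where
  constructor mkStr
  field
    size : ℕ
    rel  : Fin k → Fin size → Fin size → Bool
open FinStr public

Embedding : ∀ {k} → FinStr k → FinStr k → Set
Embedding S T =
  Σ (Fin (size S) → Fin (size T)) λ f →
    Injective _≡_ _≡_ f ×
    (∀ i x y → rel S i x y ≡ rel T i (f x) (f y))

Iso : ∀ {k} → FinStr k → FinStr k → Set
Iso S T =
  Σ (Fin (size S) → Fin (size T)) λ f →
  Σ (Fin (size T) → Fin (size S)) λ g →
    (∀ x → g (f x) ≡ x) × (∀ y → f (g y) ≡ y) ×
    (∀ i x y → rel S i x y ≡ rel T i (f x) (f y))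

IsInterval : ∀ {k} (S : FinStr k) → (Fin (size S) → Bool) → Set
IsInterval S A = ∀ i a a' x → A a ≡ true → A a' ≡ true → A x ≡ false →
  (rel S i x a ≡ rel S i x a') × (rel S i a x ≡ rel S i a' x)

Trivial : ∀ {n} → (Fin n → Bool) → Set
Trivial {n} A =
  (∀ x → A x ≡ false) ⊎
  (Σ (Fin n) λ a → ∀ x → (A x ≡ true → x ≡ a) × (x ≡ a → A x ≡ true)) ⊎
  (∀ x → A x ≡ true)

Indecomposable : ∀ {k} → FinStr k → Set
Indecomposable S = ∀ A → IsInterval S A → Trivial A

Class : ℕ → Set₁
Class k = FinStr k → Set

FiniteUpToIso : ∀ {k} → Class k → Set
FiniteUpToIso {k} C = Σ (List (FinStr k)) λ L → ∀ S → C S → Any (Iso S) L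

IndPart : ∀ {k} → Class k → Class k
IndPart C S = C S × Indecomposable S

Hereditary : ∀ {k} → Class k → Set
Hereditary {k} C = ∀ (S T : FinStr k) → C S → Embedding T S → C T

IndMinimal : ∀ {k} → Class k → Set₁
IndMinimal {k} C =
  ¬ FiniteUpToIso (IndPart C) ×
  (∀ (C' : Class k) → (∀ S → C' S → C S) → Hereditary C' →
     (Σ (FinStr k) λ S → C S × ¬ C' S) →
     FiniteUpToIso (IndPart C'))

-- relation 0: consecutivity c = {(i,i+1)}; relation 1: u_α = {(i,i) : α_i = 1}
Crel : Word → Fin 2 → ℕ → ℕ → Set
Crel α Fin.zero    x y = y ≡ suc x
Crel α (Fin.suc _) x y = (x ≡ y) × (α x ≡ true)

-- S belongs to the age of C_α iff S embeds into C_α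
-- (i.e. S is isomorphic to a finite restriction of C_α)
AgeC : Word → Class 2
AgeC α S =
  Σ (Fin (size S) → ℕ) λ f →
    Injective _≡_ _≡_ f ×
    (∀ i x y → (rel S i x y ≡ true → Crel α i (f x) (f y)) ×
               (Crel α i (f x) (f y) → rel S i x y ≡ true))

-- A finite member of the age of C_α is a finite set of naturals with the labels and consecutivity
-- inherited from α. If its image has a gap, the elements below and above the gap are unrelated,
-- so both parts are intervals; an indecomposable member with at least three elements therefore
-- has contiguous image, i.e. it is a window α[p, p+r), and every window is indecomposable.
-- If α is uniformly recurrent, every long enough window contains a translate of any given member
-- S of the age, so a hereditary subclass omitting S has only small indecomposables. Conversely,
-- for a factor u, the members of the age not embedding the window of u form a proper hereditary
-- subclass; ind-minimality bounds the size B of its indecomposables, so every window of length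
-- |u| + B embeds the window of u, which means it contains u.

module Submission where

open import Defs
open import Data.Bool using (Bool; true; false; not)
import Data.Bool.Properties as Bool
open import Data.Fin using (Fin; toℕ; fromℕ; fromℕ<; inject₁)
open import Data.Fin.Induction using (<-weakInduction)
open import Data.Fin.Patterns using (0F; 1F)
open import Data.Fin.Properties
  using (toℕ-injective; toℕ-fromℕ; toℕ-fromℕ<; toℕ-inject₁; toℕ<n; any?; all?; injective⇒≤; 2↔Bool)
open import Data.List using (List; []; _∷_; _++_; map; cartesianProductWith)
open import Data.List.Relation.Unary.Any as Any using (Any; here; there)
open import Data.List.Relation.Unary.Any.Properties using (++⁺ˡ; ++⁺ʳ; map⁺; cartesianProductWith⁺)
open import Data.Nat using (ℕ; zero; suc; _+_; _∸_; _≤_; _<_; z≤n; s≤s; z<s; _≤?_)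
open import Data.Nat.ListAction using (sum)
open import Data.Nat.Properties
open import Data.Product using (Σ; ∃; _×_; _,_; proj₁; proj₂; swap; map₂)
open import Data.Sum using (inj₁; inj₂)
open import Data.Vec using (Vec; lookup; tabulate)
open import Data.Vec.Properties using (lookup∘tabulate)
import Data.Vec.Functional as Vector
open import Data.Vec.Functional.Relation.Binary.Pointwise using (Pointwise)
open import Function using (_∘_; id; _⇔_; mk⇔; Injection)
open import Function.Construct.Symmetry using (↔-sym)
open import Function.Definitions using (Injective)
open import Function.Properties.Inverse using (↔⇒↣)
open import Relation.Binary.Definitions using (Decidable)
open import Relation.Binary.PropositionalEquality
open import Relation.Nullary using (¬_; Dec; yes; no; does; contradiction; ¬?)
open import Relation.Nullary.Decidable using (_×-dec_; dec-true; dec-false; does-⇔; decidable-stable)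

does≡true⇒ : ∀ {a} {A : Set a} (a? : Dec A) → does a? ≡ true → A
does≡true⇒ (yes a) _ = a

does≡false⇒¬ : ∀ {a} {A : Set a} (a? : Dec A) → does a? ≡ false → ¬ A
does≡false⇒¬ (no ¬a) _ = ¬a

constant-of-steps : ∀ {r} (A : Fin (suc r) → Bool) → (∀ j → A (inject₁ j) ≡ A (Fin.suc j)) →
  ∀ x → A x ≡ A 0F
constant-of-steps A step = <-weakInduction (λ x → A x ≡ A 0F) refl (λ j IH → trans (sym (step j)) IH)

change-point : ∀ {r} (A : Fin (suc r) → Bool) {a b} → A a ≡ true → A b ≡ false →
  ∃ λ j → A (inject₁ j) ≢ A (Fin.suc j)
change-point A {a} {b} Aa Ab with any? (λ j → ¬? (A (inject₁ j) Bool.≟ A (Fin.suc j)))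
... | yes found = found
... | no none = contradiction true≡false λ ()
  where
  step : ∀ j → A (inject₁ j) ≡ A (Fin.suc j)
  step j = decidable-stable (A (inject₁ j) Bool.≟ A (Fin.suc j)) (λ ne → none (j , ne))
  true≡false : true ≡ false
  true≡false = begin
    true ≡⟨ sym Aa ⟩
    A a  ≡⟨ constant-of-steps A step a ⟩
    A 0F ≡⟨ sym (constant-of-steps A step b) ⟩
    A b  ≡⟨ Ab ⟩
    false ∎
    where open ≡-Reasoning

injective-Bool⇒≤2 : ∀ {n} {A : Fin n → Bool} → Injective _≡_ _≡_ A → n ≤ 2
injective-Bool⇒≤2 {A = A} A-inj =
  injective⇒≤ {f = Injection.to Bool↣2 ∘ A} (A-inj ∘ Injection.injective Bool↣2)
  where Bool↣2 = ↔⇒↣ (↔-sym 2↔Bool)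

injective-bounded⇒≤ : ∀ {n b} {g : Fin n → ℕ} → Injective _≡_ _≡_ g → (∀ z → g z < b) → n ≤ b
injective-bounded⇒≤ {g = g} g-inj g<b = injective⇒≤ {f = λ z → fromℕ< (g<b z)} λ {z} {z'} e →
  g-inj (trans (sym (toℕ-fromℕ< (g<b z))) (trans (cong toℕ e) (toℕ-fromℕ< (g<b z'))))

minimum-at : ∀ {n} (f : Fin n → ℕ) → Fin n → ∃ λ x → ∀ z → f x ≤ f z
minimum-at {suc zero} f _ = 0F , λ { 0F → ≤-refl }
minimum-at {suc (suc n)} f _ with minimum-at (f ∘ Fin.suc) 0F
... | x , x-min with f 0F ≤? f (Fin.suc x)
... | yes f0≤ = 0F , λ { 0F → ≤-refl ; (Fin.suc z) → ≤-trans f0≤ (x-min z) }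
... | no f0≰ = Fin.suc x , λ { 0F → <⇒≤ (≰⇒> f0≰) ; (Fin.suc z) → x-min z }

strict-upper-bound : ∀ {n} (g : Fin n → ℕ) → ∃ λ ℓ → ∀ s → g s < ℓ
strict-upper-bound {zero} g = 0 , λ ()
strict-upper-bound {suc n} g with strict-upper-bound (g ∘ Fin.suc)
... | ℓ , g<ℓ = suc (g 0F) + ℓ , λ { 0F → m≤m+n _ _ ; (Fin.suc s) → ≤-trans (g<ℓ s) (m≤n+m _ _) }

functions : ∀ {A : Set} n → List A → List (Fin n → A)
functions zero xs = Vector.[] ∷ []
functions (suc n) xs = cartesianProductWith Vector._∷_ xs (functions n xs)

functions-complete : ∀ {A : Set} {_≈_ : A → A → Set} {xs} → (∀ a → Any (a ≈_) xs) →
  ∀ n (h : Fin n → A) → Any (Pointwise _≈_ h) (functions n xs)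
functions-complete covers zero h = here λ ()
functions-complete covers (suc n) h =
  cartesianProductWith⁺ Vector._∷_ (λ h0≈ h+≈ → λ { 0F → h0≈ ; (Fin.suc x) → h+≈ x })
    (covers (h 0F)) (functions-complete covers n (h ∘ Fin.suc))

Embedding-id : ∀ {k} {S : FinStr k} → Embedding S S
Embedding-id = id , id , λ _ _ _ → refl

Embedding-trans : ∀ {k} {R S T : FinStr k} → Embedding R S → Embedding S T → Embedding R T
Embedding-trans (f , f-inj , f-rel) (g , g-inj , g-rel) =
  g ∘ f , f-inj ∘ g-inj , λ i x y → trans (f-rel i x y) (g-rel i (f x) (f y))

Iso⇒size≤ : ∀ {k} {S T : FinStr k} → Iso S T → size S ≤ size T
Iso⇒size≤ (f , g , g∘f≗id , _) =
  injective⇒≤ {f = f} λ {x} {y} e → trans (sym (g∘f≗id x)) (trans (cong g e) (g∘f≗id y))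

structures : ∀ k → ℕ → List (FinStr k)
structures k zero = []
structures k (suc n) =
  map (mkStr n) (functions k (functions n (functions n (true ∷ false ∷ [])))) ++ structures k n

structures-complete : ∀ {k} n (S : FinStr k) → size S < n → Any (Iso S) (structures k n)
structures-complete {k} (suc n) (mkStr m ρ) m<1+n with m≤n⇒m<n∨m≡n (≤-pred m<1+n)
... | inj₁ m<n = ++⁺ʳ _ (structures-complete n (mkStr m ρ) m<n)
... | inj₂ refl = ++⁺ˡ (map⁺ (Any.map (λ ρ≗ρ' → id , id , (λ _ → refl) , (λ _ → refl) , ρ≗ρ')
                   (functions-complete (functions-complete (functions-complete Bool-covered m) m) k ρ)))
  where
  Bool-covered : ∀ b → Any (b ≡_) (true ∷ false ∷ [])
  Bool-covered true = here refl
  Bool-covered false = there (here refl)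

size-bounded⇒finite : ∀ {k} {C : Class k} n → (∀ S → C S → size S < n) → FiniteUpToIso C
size-bounded⇒finite {k} n bounded = structures k n , λ S CS → structures-complete n S (bounded S CS)

finite⇒size-bounded : ∀ {k} {C : Class k} → FiniteUpToIso C → ∃ λ n → ∀ S → C S → size S ≤ n
finite⇒size-bounded (L , covered) = sum (map size L) , λ S CS → bound L (covered S CS)
  where
  bound : ∀ {S} L → Any (Iso S) L → size S ≤ sum (map size L)
  bound (T ∷ L) (here S≅T) = ≤-trans (Iso⇒size≤ {T = T} S≅T) (m≤m+n _ _)
  bound (T ∷ L) (there S∈L) = ≤-trans (bound L S∈L) (m≤n+m _ _)

Separates : ∀ {k} (S : FinStr k) → (Fin (size S) → Bool) → Set
Separates S A = ∀ i a x → A a ≡ true → A x ≡ false → rel S i a x ≡ false × rel S i x a ≡ false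

separates⇒interval : ∀ {k} {S : FinStr k} {A} → Separates S A → IsInterval S A
separates⇒interval sep i a a' x Aa Aa' Ax =
  trans (proj₂ (sep i a x Aa Ax)) (sym (proj₂ (sep i a' x Aa' Ax))) ,
  trans (proj₁ (sep i a x Aa Ax)) (sym (proj₁ (sep i a' x Aa' Ax)))

separates-complement : ∀ {k} {S : FinStr k} {A} → Separates S A → Separates S (not ∘ A)
separates-complement sep i a x ¬Aa ¬Ax = swap (sep i x a (flip-not ¬Ax) (flip-not ¬Aa))
  where
  flip-not : ∀ {b c} → not b ≡ c → b ≡ not c
  flip-not {b} refl = sym (Bool.not-involutive b)

proper-trivial⇒singleton : ∀ {n} {A : Fin n → Bool} → Trivial A → ∀ {x y} → A x ≡ true → A y ≡ false →
  ∃ λ a → ∀ z → A z ≡ true → z ≡ a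
proper-trivial⇒singleton (inj₁ all-false) {x} Ax _ = contradiction (trans (sym Ax) (all-false x)) λ ()
proper-trivial⇒singleton (inj₂ (inj₁ (a , only-a))) _ _ = a , λ z → proj₁ (only-a z)
proper-trivial⇒singleton (inj₂ (inj₂ all-true)) {y = y} _ Ay =
  contradiction (trans (sym (all-true y)) Ay) λ ()

separated⇒size≤2 : ∀ {k} {S : FinStr k} → Indecomposable S → ∀ {A} → Separates S A →
  ∀ {x y} → A x ≡ true → A y ≡ false → size S ≤ 2
separated⇒size≤2 S-ind {A} sep Ax Ay = injective-Bool⇒≤2 A-injective
  where
  inside = proper-trivial⇒singleton (S-ind A (separates⇒interval sep)) Ax Ay
  outside = proper-trivial⇒singleton (S-ind (not ∘ A) (separates⇒interval (separates-complement sep)))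
              (cong not Ay) (cong not Ax)
  A-injective : Injective _≡_ _≡_ A
  A-injective {z} {z'} Az≡Az' with A z in Az
  ... | true = trans (proj₂ inside z Az) (sym (proj₂ inside z' (sym Az≡Az')))
  ... | false = trans (proj₂ outside z (cong not Az)) (sym (proj₂ outside z' (cong not (sym Az≡Az'))))

Crel? : ∀ α i → Decidable (Crel α i)
Crel? α 0F x y = y ≟ suc x
Crel? α 1F x y = x ≟ y ×-dec α x Bool.≟ true

Crel⇒near : ∀ {α} i {a b} → Crel α i a b → a ≤ b × b ≤ suc a
Crel⇒near 0F refl = n≤1+n _ , ≤-refl
Crel⇒near 1F (refl , _) = ≤-refl , n≤1+n _

Crel-shift : ∀ α i D {a b} → α a ≡ α (D + a) → Crel α i a b ⇔ Crel α i (D + a) (D + b)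
Crel-shift α 0F D {a} _ =
  mk⇔ (λ e → trans (cong (D +_) e) (+-suc D a))
      (λ e → +-cancelˡ-≡ D _ _ (trans e (sym (+-suc D a))))
Crel-shift α 1F D label =
  mk⇔ (λ (e , a∈u) → cong (D +_) e , trans (sym label) a∈u)
      (λ (e , a∈u) → +-cancelˡ-≡ D _ _ e , trans label a∈u)

age-rel : ∀ {α} {S : FinStr 2} (S∈ : AgeC α S) i x y →
  rel S i x y ≡ does (Crel? α i (proj₁ S∈ x) (proj₁ S∈ y))
age-rel {α} (f , _ , f-rel) i x y with Crel? α i (f x) (f y)
... | yes c = proj₂ (f-rel i x y) c
... | no ¬c = Bool.¬-not (¬c ∘ proj₁ (f-rel i x y))

age-hereditary : ∀ α → Hereditary (AgeC α)
age-hereditary α S T (f , f-inj , f-rel) (g , g-inj , g-rel) =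
  f ∘ g , g-inj ∘ f-inj ,
  λ i x y → (λ r → proj₁ (f-rel i (g x) (g y)) (trans (sym (g-rel i x y)) r)) ,
            (λ c → trans (g-rel i x y) (proj₂ (f-rel i (g x) (g y)) c))

restrict : Word → (n : ℕ) → (Fin n → ℕ) → FinStr 2
restrict α n e = mkStr n λ i x y → does (Crel? α i (e x) (e y))

restrict-∈-age : ∀ α {n} {e : Fin n → ℕ} → Injective _≡_ _≡_ e → AgeC α (restrict α n e)
restrict-∈-age α {e = e} e-inj =
  e , e-inj , λ i x y → does≡true⇒ (Crel? α i (e x) (e y)) , dec-true (Crel? α i (e x) (e y))

window : Word → ℕ → ℕ → FinStr 2
window α p r = restrict α r (λ x → p + toℕ x)

window-∈-age : ∀ α p r → AgeC α (window α p r)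
window-∈-age α p r = restrict-∈-age α (toℕ-injective ∘ +-cancelˡ-≡ p _ _)

window-next : ∀ α p {r} {x y : Fin r} → rel (window α p r) 0F x y ≡ true → toℕ y ≡ suc (toℕ x)
window-next α p {x = x} {y} r≡true =
  +-cancelˡ-≡ p _ _ (trans (does≡true⇒ (p + toℕ y ≟ suc (p + toℕ x)) r≡true) (sym (+-suc p (toℕ x))))

window-step : ∀ α p {r} (j : Fin r) → rel (window α p (suc r)) 0F (inject₁ j) (Fin.suc j) ≡ true
window-step α p j =
  dec-true (_ ≟ _) (trans (+-suc p (toℕ j)) (cong (λ v → suc (p + v)) (sym (toℕ-inject₁ j))))

window-label : ∀ α p {r} (x : Fin r) → rel (window α p r) 1F x x ≡ α (p + toℕ x)
window-label α p x =
  Bool.⇔→≡ (mk⇔ (proj₂ ∘ does≡true⇒ (Crel? α 1F a a)) (dec-true (Crel? α 1F a a) ∘ (refl ,_)))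
  where a = p + toℕ x

window-indecomposable : ∀ α p r → Indecomposable (window α p r)
window-indecomposable α p zero A _ = inj₁ λ ()
window-indecomposable α p (suc r) A A-int
  with any? (λ x → A x Bool.≟ true) | any? (λ x → A x Bool.≟ false)
... | no ∄true | _ = inj₁ λ x → Bool.¬-not (λ Ax → ∄true (x , Ax))
... | _ | no ∄false = inj₂ (inj₂ λ x → Bool.¬-not (λ Ax → ∄false (x , Ax)))
... | yes (a , Aa) | yes (b , Ab) = inj₂ (inj₁ (singleton (change-point A Aa Ab)))
  where
  Singleton : Set
  Singleton = Σ (Fin (suc r)) λ a → ∀ x → (A x ≡ true → x ≡ a) × (x ≡ a → A x ≡ true)
  singleton : ∃ (λ j → A (inject₁ j) ≢ A (Fin.suc j)) → Singleton
  singleton (j , A-changes) with A (inject₁ j) in Aj | A (Fin.suc j) in Aj'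
  ... | true | true = contradiction refl A-changes
  ... | false | false = contradiction refl A-changes
  ... | true | false = inject₁ j , λ x → only x , λ { refl → Aj }
    where
    only : ∀ x → A x ≡ true → x ≡ inject₁ j
    only x Ax = toℕ-injective (trans (suc-injective (sym x-next)) (sym (toℕ-inject₁ j)))
      where
      x-next : toℕ (Fin.suc j) ≡ suc (toℕ x)
      x-next = window-next α p
        (trans (proj₂ (A-int 0F x (inject₁ j) (Fin.suc j) Ax Aj Aj')) (window-step α p j))
  ... | false | true = Fin.suc j , λ x → only x , λ { refl → Aj' }
    where
    only : ∀ x → A x ≡ true → x ≡ Fin.suc j
    only x Ax = toℕ-injective (trans x-next (cong suc (toℕ-inject₁ j)))
      where
      x-next : toℕ x ≡ suc (toℕ (inject₁ j))
      x-next = window-next α p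
        (trans (proj₁ (A-int 0F x (Fin.suc j) (inject₁ j) Ax Aj' Aj)) (window-step α p j))

age-indecomposables-infinite : ∀ α → ¬ FiniteUpToIso (IndPart (AgeC α))
age-indecomposables-infinite α finite =
  1+n≰n (bounded (window α 0 (suc n)) (window-∈-age α 0 (suc n) , window-indecomposable α 0 (suc n)))
  where
  n = proj₁ (finite⇒size-bounded finite)
  bounded = proj₂ (finite⇒size-bounded finite)

module _ {α : Word} {T : FinStr 2} (T∈ : AgeC α T) (T-ind : Indecomposable T) (3≤|T| : 3 ≤ size T) where
  private
    f = proj₁ T∈
    f-inj = proj₁ (proj₂ T∈)

  age-gap⇒separates : ∀ t → (∀ z → f z ≢ suc t) → Separates T (λ z → does (f z ≤? t))
  age-gap⇒separates t gap i a x a-low x-high =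
    trans (age-rel T∈ i a x) (dec-false (Crel? α i (f a) (f x)) λ c →
      <⇒≱ far (proj₂ (Crel⇒near i c))) ,
    trans (age-rel T∈ i x a) (dec-false (Crel? α i (f x) (f a)) λ c →
      <⇒≱ (<-trans (n<1+n (f a)) far) (proj₁ (Crel⇒near i c)))
    where
    far : suc (f a) < f x
    far = ≤-<-trans (s≤s (does≡true⇒ (f a ≤? t) a-low))
            (≤∧≢⇒< (≰⇒> (does≡false⇒¬ (f x ≤? t) x-high)) (λ e → gap x (sym e)))

  image-gap-free : ∀ t x → f x ≤ t → (∀ z → f z ≢ suc t) → ∀ z → f z ≤ t
  image-gap-free t x fx≤t gap z with f z ≤? t
  ... | yes fz≤t = fz≤t
  ... | no fz≰t = contradiction (separated⇒size≤2 T-ind (age-gap⇒separates t gap) x-low z-high) (<⇒≱ 3≤|T|)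
    where
    x-low = dec-true (f x ≤? t) fx≤t
    z-high = dec-false (f z ≤? t) fz≰t

  image-contiguous : ∃ λ m → ∀ k → k < size T → ∃ λ z → f z ≡ m + k
  image-contiguous = f x₀ , covered
    where
    x₀-min = minimum-at f (fromℕ< (≤-trans (s≤s z≤n) 3≤|T|))
    x₀ = proj₁ x₀-min
    m = f x₀
    covered : ∀ k → k < size T → ∃ λ z → f z ≡ m + k
    covered zero _ = x₀ , sym (+-identityʳ m)
    covered (suc k) k<|T| with any? (λ z → f z ≟ m + suc k)
    ... | yes hit = hit
    ... | no miss = contradiction (injective-bounded⇒≤ offset-inj offset<) (<⇒≱ k<|T|)
      where
      previous = covered k (<-trans (n<1+n k) k<|T|)
      below : ∀ z → f z ≤ m + k
      below = image-gap-free (m + k) (proj₁ previous) (≤-reflexive (proj₂ previous))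
                (λ z e → miss (z , trans e (sym (+-suc m k))))
      offset-inj : Injective _≡_ _≡_ (λ z → f z ∸ m)
      offset-inj = f-inj ∘ ∸-cancelʳ-≡ (proj₂ x₀-min _) (proj₂ x₀-min _)
      offset< : ∀ z → f z ∸ m < suc k
      offset< z = s≤s (m≤n+o⇒m∸n≤o (f z) m (below z))

translation-embedding : ∀ {α} {S T : FinStr 2} (S∈ : AgeC α S) (T∈ : AgeC α T)
  (h : Fin (size S) → Fin (size T)) D →
  (∀ s → proj₁ T∈ (h s) ≡ D + proj₁ S∈ s) → (∀ s → α (proj₁ S∈ s) ≡ α (D + proj₁ S∈ s)) →
  Embedding S T
translation-embedding {α} {S} {T} S∈@(g , g-inj , _) T∈@(f , _ , _) h D translates labels =
  h , h-inj , h-rel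
  where
  h-inj : Injective _≡_ _≡_ h
  h-inj {s} {s'} e =
    g-inj (+-cancelˡ-≡ D _ _ (trans (sym (translates s)) (trans (cong f e) (translates s'))))
  h-rel : ∀ i s s' → rel S i s s' ≡ rel T i (h s) (h s')
  h-rel i s s' = begin
    rel S i s s'                           ≡⟨ age-rel S∈ i s s' ⟩
    does (Crel? α i (g s) (g s'))          ≡⟨ does-⇔ (Crel-shift α i D {b = g s'} (labels s))
                                                     (Crel? α i _ _) (Crel? α i _ _) ⟩
    does (Crel? α i (D + g s) (D + g s'))  ≡⟨ sym (cong₂ (λ a b → does (Crel? α i a b))
                                                          (translates s) (translates s')) ⟩
    does (Crel? α i (f (h s)) (f (h s')))  ≡⟨ sym (age-rel T∈ i (h s) (h s')) ⟩
    rel T i (h s) (h s')                   ∎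
    where open ≡-Reasoning

large-indecomposables-embed : ∀ {α} → UniformlyRecurrent α → ∀ {S} → AgeC α S →
  ∃ λ n → ∀ T → AgeC α T → Indecomposable T → n ≤ size T → Embedding S T
large-indecomposables-embed {α} α-ur {S} S∈@(g , _) with strict-upper-bound g
... | ℓ , g<ℓ with α-ur ℓ (tabulate (α ∘ toℕ)) (0 , lookup∘tabulate _)
... | r , recurs = 3 + r , embed
  where
  embed : ∀ T → AgeC α T → Indecomposable T → 3 + r ≤ size T → Embedding S T
  embed T T∈ T-ind 3+r≤|T| with image-contiguous T∈ T-ind (≤-trans (m≤m+n 3 r) 3+r≤|T|)
  ... | m , contiguous with recurs m
  ... | q , q+ℓ≤r , prefix-at = translation-embedding S∈ T∈ h (m + q) translates labels
    where
    inside : ∀ s → q + g s < size T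
    inside s = <-≤-trans (+-monoʳ-< q (g<ℓ s)) (≤-trans q+ℓ≤r (≤-trans (m≤n+m r 3) 3+r≤|T|))
    h : Fin (size S) → Fin (size T)
    h s = proj₁ (contiguous (q + g s) (inside s))
    translates : ∀ s → proj₁ T∈ (h s) ≡ m + q + g s
    translates s = trans (proj₂ (contiguous (q + g s) (inside s))) (sym (+-assoc m q (g s)))
    labels : ∀ s → α (g s) ≡ α (m + q + g s)
    labels s = begin
      α (g s)                        ≡⟨ cong α (sym toℕj≡gs) ⟩
      α (toℕ j)                      ≡⟨ sym (lookup∘tabulate _ j) ⟩
      lookup (tabulate (α ∘ toℕ)) j  ≡⟨ prefix-at j ⟩
      α (m + q + toℕ j)              ≡⟨ cong (λ v → α (m + q + v)) toℕj≡gs ⟩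
      α (m + q + g s)                ∎
      where
      open ≡-Reasoning
      j = fromℕ< (g<ℓ s)
      toℕj≡gs = toℕ-fromℕ< (g<ℓ s)

ur⇒ind-minimal : ∀ {α} → UniformlyRecurrent α → IndMinimal (AgeC α)
ur⇒ind-minimal {α} α-ur = age-indecomposables-infinite α , proper-finite
  where
  proper-finite : ∀ C' → (∀ S → C' S → AgeC α S) → Hereditary C' →
    (Σ (FinStr 2) λ S → AgeC α S × ¬ C' S) → FiniteUpToIso (IndPart C')
  proper-finite C' C'⊆age C'-her (S , S∈ , S∉C') with large-indecomposables-embed α-ur S∈
  ... | n , embed = size-bounded⇒finite n λ T (T∈C' , T-ind) →
    ≰⇒> λ n≤|T| → S∉C' (C'-her T S T∈C' (embed T (C'⊆age T T∈C') T-ind n≤|T|))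

occurs? : ∀ α i {n} (u : Vec Bool n) → Dec (OccursAt α i u)
occurs? α i u = all? (λ j → lookup u j Bool.≟ α (i + toℕ j))

window-embedding⇒occurs : ∀ {α i p r n} {u : Vec Bool (suc n)} → OccursAt α i u →
  Embedding (window α i (suc n)) (window α p r) → Σ ℕ λ q → q + suc n ≤ r × OccursAt α (p + q) u
window-embedding⇒occurs {α} {i} {p} {r} {n} {u} u-at-i (h , _ , h-rel) = q , last-inside , u-at-p+q
  where
  open ≡-Reasoning
  q = toℕ (h 0F)
  position : ∀ j → toℕ (h j) ≡ q + toℕ j
  position = <-weakInduction (λ j → toℕ (h j) ≡ q + toℕ j) (sym (+-identityʳ q)) step
    where
    step : ∀ j → toℕ (h (inject₁ j)) ≡ q + toℕ (inject₁ j) → toℕ (h (Fin.suc j)) ≡ q + suc (toℕ j)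
    step j IH = begin
      toℕ (h (Fin.suc j))        ≡⟨ window-next α p (trans (sym (h-rel 0F (inject₁ j) (Fin.suc j)))
                                                            (window-step α i j)) ⟩
      suc (toℕ (h (inject₁ j)))  ≡⟨ cong suc IH ⟩
      suc (q + toℕ (inject₁ j))  ≡⟨ cong (λ v → suc (q + v)) (toℕ-inject₁ j) ⟩
      suc (q + toℕ j)            ≡⟨ sym (+-suc q (toℕ j)) ⟩
      q + suc (toℕ j)            ∎
  last-inside : q + suc n ≤ r
  last-inside = subst (_≤ r) last-position (toℕ<n (h (fromℕ n)))
    where
    last-position : suc (toℕ (h (fromℕ n))) ≡ q + suc n
    last-position = begin
      suc (toℕ (h (fromℕ n)))  ≡⟨ cong suc (position (fromℕ n)) ⟩
      suc (q + toℕ (fromℕ n))  ≡⟨ cong (λ v → suc (q + v)) (toℕ-fromℕ n) ⟩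
      suc (q + n)              ≡⟨ sym (+-suc q n) ⟩
      q + suc n                ∎
  u-at-p+q : OccursAt α (p + q) u
  u-at-p+q j = begin
    lookup u j                         ≡⟨ u-at-i j ⟩
    α (i + toℕ j)                      ≡⟨ sym (window-label α i j) ⟩
    rel (window α i (suc n)) 1F j j    ≡⟨ h-rel 1F j j ⟩
    rel (window α p r) 1F (h j) (h j)  ≡⟨ window-label α p (h j) ⟩
    α (p + toℕ (h j))                  ≡⟨ cong (λ v → α (p + v)) (position j) ⟩
    α (p + (q + toℕ j))                ≡⟨ cong α (sym (+-assoc p q (toℕ j))) ⟩
    α (p + q + toℕ j)                  ∎

Avoiding : Word → FinStr 2 → Class 2
Avoiding α U T = AgeC α T × ¬ Embedding U T

avoiding-hereditary : ∀ α U → Hereditary (Avoiding α U)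
avoiding-hereditary α U S T (S∈ , ¬U↪S) T↪S =
  age-hereditary α S T S∈ T↪S , λ U↪T → ¬U↪S (Embedding-trans {R = U} {T} {S} U↪T T↪S)

ind-minimal⇒ur : ∀ {α} → IndMinimal (AgeC α) → UniformlyRecurrent α
ind-minimal⇒ur _ zero u _ = 0 , λ _ → 0 , z≤n , λ ()
ind-minimal⇒ur {α} (_ , minimal) (suc n) u (i , u-at-i) = B + suc n , occurs-within
  where
  U = window α i (suc n)
  bounded : ∃ λ B → ∀ T → IndPart (Avoiding α U) T → size T ≤ B
  bounded = finite⇒size-bounded (minimal (Avoiding α U) (λ _ → proj₁) (avoiding-hereditary α U)
              (U , window-∈-age α i (suc n) , λ (_ , ¬U↪U) → ¬U↪U Embedding-id))
  B = proj₁ bounded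
  -- W cannot avoid U, so it embeds U only up to double negation; a bounded search for the
  -- occurrence makes the witness explicit.
  occurs-within : ∀ p → Σ ℕ λ q → q + suc n ≤ B + suc n × OccursAt α (p + q) u
  occurs-within p = map₂ proj₂ (decidable-stable (anyUpTo? P? (B + suc n)) ¬¬found)
    where
    W = window α p (B + suc n)
    P : ℕ → Set
    P q = q + suc n ≤ B + suc n × OccursAt α (p + q) u
    P? : ∀ q → Dec (P q)
    P? q = (q + suc n ≤? B + suc n) ×-dec occurs? α (p + q) u
    found : Embedding U W → ∃ λ q → q < B + suc n × P q
    found U↪W with window-embedding⇒occurs {u = u} u-at-i U↪W
    ... | q , inside , u-at = q , <-≤-trans (m<m+n q z<s) inside , inside , u-at
    ¬¬found : ¬ ¬ ∃ λ q → q < B + suc n × P q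
    ¬¬found none = m+1+n≰m B (proj₂ bounded W (W-avoids-U , window-indecomposable α p (B + suc n)))
      where W-avoids-U = window-∈-age α p (B + suc n) , none ∘ found

theorem5p23 : ∀ (α : Word) →
    (UniformlyRecurrent α → IndMinimal (AgeC α)) × (IndMinimal (AgeC α) → UniformlyRecurrent α)
theorem5p23 α = ur⇒ind-minimal , ind-minimal⇒ur
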